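{- For a cellular pseudomanifold $M=(X,<)$, the dual $M^{\ast}=(X,<^{\ast})$, where $x<^{\ast}y$ if and only if $y<x$, is a cellular pseudomanifold.
   Context: A finite lattice $(X,<)$ is ranked if there is $\rho:X\to\mathbb N$ such that for each $x$ every maximal chain from $\mathbf 0$ to $x$ has length $\rho(x)$. For a ranked lattice $L$ with top $\mathbf 1$, $\Lambda(L)$ is the graph whose vertices are the elements of rank $\rho(\mathbf 1)-1$, two such $\sigma\ne\gamma$ being adjacent iff $\rho(\sigma\wedge\gamma)=\rho(\mathbf 1)-2$. A cellular pseudomanifold is a finite ranked lattice $M$ such that for all $x<z$: (i) if $\rho(z)=\rho(x)+2$ there are exactly two $y$ with $x<y<z$; (ii) if $\rho(z)>\rho(x)+2$ then $\Lambda([x,z])$ is connected, where $[x,z]=\{y:x\le y\le z\}$ with the induced order. -}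

module Defs where

open import Data.Nat using (ℕ; zero; suc; _+_; _<_)
open import Data.Fin using (Fin)
open import Data.Bool using (Bool; T)
open import Data.Product using (Σ; Σ-syntax; ∃; ∃-syntax; _×_; _,_)
open import Data.Sum using (_⊎_)
open import Data.Empty using (⊥)
open import Relation.Nullary using (¬_)
open import Relation.Binary.PropositionalEquality using (_≡_; _≢_)
open import Relation.Binary.Construct.Closure.ReflexiveTransitive using (Star)

module Order {n : ℕ} (R : Fin n → Fin n → Bool) where

  X : Set
  X = Fin n

  _⊏_ : X → X → Set
  x ⊏ y = T (R x y)

  _⊑_ : X → X → Set
  x ⊑ y = x ⊏ y ⊎ x ≡ y

  IsStrictPartialOrder : Set
  IsStrictPartialOrder =
    (∀ x → ¬ (x ⊏ x)) × (∀ x y z → x ⊏ y → y ⊏ z → x ⊏ z)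

  IsMeet : X → X → X → Set
  IsMeet a b m = m ⊑ a × m ⊑ b × (∀ c → c ⊑ a → c ⊑ b → c ⊑ m)

  IsJoin : X → X → X → Set
  IsJoin a b j = a ⊑ j × b ⊑ j × (∀ c → a ⊑ c → b ⊑ c → j ⊑ c)

  IsLattice : Set
  IsLattice = IsStrictPartialOrder
            × (∀ a b → Σ[ m ∈ X ] IsMeet a b m)
            × (∀ a b → Σ[ j ∈ X ] IsJoin a b j)

  Covers : X → X → Set
  Covers x y = x ⊏ y × (∀ w → x ⊏ w → w ⊏ y → ⊥)

  -- MaxChain a b k : a maximal chain a = x₀ < x₁ < ... < x_k = b
  -- (maximal in the interval [a,b], i.e. every step is a covering),
  -- of length k.
  data MaxChain : X → X → ℕ → Set where
    done : ∀ {a} → MaxChain a a 0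
    step : ∀ {a b c k} → Covers a b → MaxChain b c k → MaxChain a c (suc k)

  IsBottom : X → Set
  IsBottom b = ∀ x → b ⊑ x

  IsTop : X → Set
  IsTop t = ∀ x → x ⊑ t

  IsRankFunction : X → (X → ℕ) → Set
  IsRankFunction bot ρ = ∀ x k → MaxChain bot x k → k ≡ ρ x

  Connected : (V : X → Set) → (E : X → X → Set) → Set
  Connected V E = ∀ (u v : Σ X V) → Star (λ (p q : Σ X V) → E (Σ.proj₁ p) (Σ.proj₁ q)) u v
    where open Data.Product

  -- Ranks in
  -- the interval are ρ(y) - ρ(x), so the top z has interval rank ρ z - ρ x;
  -- vertices are y ∈ [x,z] of interval rank (ρ z - ρ x) - 1, i.e. ρ y + 1 ≡ ρ z;
  -- σ ≠ γ adjacent iff their meet (the meet in the interval coincides with the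
  -- meet in the lattice) has interval rank (ρ z - ρ x) - 2, i.e. ρ m + 2 ≡ ρ z.
  ΛVertex : (ρ : X → ℕ) → X → X → X → Set
  ΛVertex ρ x z y = x ⊑ y × y ⊑ z × ρ y + 1 ≡ ρ z

  ΛAdj : (ρ : X → ℕ) → X → X → X → Set
  ΛAdj ρ z σ γ = σ ≢ γ × Σ[ m ∈ X ] (IsMeet σ γ m × ρ m + 2 ≡ ρ z)

  ΛConnected : (ρ : X → ℕ) → X → X → Set
  ΛConnected ρ x z = Connected (ΛVertex ρ x z) (ΛAdj ρ z)

  ExactlyTwoBetween : X → X → Set
  ExactlyTwoBetween x z =
    Σ[ y₁ ∈ X ] Σ[ y₂ ∈ X ]
      (y₁ ≢ y₂ × (x ⊏ y₁ × y₁ ⊏ z) × (x ⊏ y₂ × y₂ ⊏ z)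
       × (∀ y → x ⊏ y → y ⊏ z → y ≡ y₁ ⊎ y ≡ y₂))

  IsCellularPseudomanifold : Set
  IsCellularPseudomanifold =
    IsLattice ×
    Σ[ bot ∈ X ] Σ[ ρ ∈ (X → ℕ) ]
      (IsBottom bot × IsRankFunction bot ρ
       × (∀ x z → x ⊏ z → ρ z ≡ ρ x + 2 → ExactlyTwoBetween x z)
       × (∀ x z → x ⊏ z → ρ x + 2 < ρ z → ΛConnected ρ x z))

dual : {n : ℕ} → (Fin n → Fin n → Bool) → (Fin n → Fin n → Bool)
dual R x y = R y x

CellularPseudomanifold : {n : ℕ} → (Fin n → Fin n → Bool) → Set
CellularPseudomanifold R = Order.IsCellularPseudomanifold R

{-# OPTIONS --safe #-}
module Submission where

-- The dual order is ranked by the corank ρ*(x) = ρ(𝟏) − ρ(x), where 𝟏 is the join of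
-- all elements: maximal chains reverse, meets and joins swap, and condition (i) is
-- self-dual.  Condition (ii) for the dual says that for every interval [z,x] the atoms
-- of [z,x] form a connected graph, two atoms being adjacent when their join has rank
-- ρ(z) + 2.  This goes by well-founded induction on x.  If ρ(x) ≤ ρ(z) + 2, any two
-- distinct atoms are adjacent.  Otherwise every atom lies below a coatom, atoms below a
-- common coatom c are connected by induction on [z,c], and two coatoms adjacent in
-- Λ([z,x]) lie above a common atom (any atom below their meet), so the connectivity of
-- Λ([z,x]) carries over.  Finiteness enters only through the well-foundedness of strict
-- orders on Fin n, which provides maximal chains between comparable elements.

open import Defs
open import Data.Nat using (ℕ; zero; suc; _+_; _∸_; _≤_; _<_; _<?_; z<s)
open import Data.Nat.Properties
  using (≤-refl; ≤-antisym; <-irrefl; <⇒≤; ≮⇒≥; m<m+n; +-suc; +-comm; +-assoc;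
         +-cancelˡ-≡; +-cancelʳ-≡; +-cancelʳ-<; +-monoʳ-<; n<1+n; m+n∸m≡n; m+[n∸m]≡n;
         ≡-irrelevant; module ≤-Reasoning)
open import Data.Fin using (Fin; zero; suc; _≟_)
open import Data.Fin.Properties using (any?)
open import Data.Fin.Induction using (spo-wellFounded; spo-noetherian)
open import Data.Bool using (Bool)
open import Data.Bool.Properties using (T?; T-irrelevant)
open import Data.Product using (Σ; Σ-syntax; ∃-syntax; _×_; _,_; proj₁; proj₂; map₂)
open import Data.Sum using (inj₁; inj₂)
open import Data.Empty using (⊥-elim)
open import Function using (_∘_; id; flip)
open import Induction.WellFounded using (Acc; acc; WellFounded)
open import Level using (0ℓ)
open import Relation.Binary.Core using (Rel)
import Relation.Binary.Structures as Structures
open import Relation.Nullary using (¬_; yes; no)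
open import Relation.Nullary.Decidable using (_×-dec_)
open import Relation.Binary.PropositionalEquality
  using (_≡_; _≢_; refl; sym; trans; cong; subst; subst₂; isEquivalence; resp₂; module ≡-Reasoning)
open import Relation.Binary.Construct.Closure.ReflexiveTransitive using (Star; ε; _◅_; _◅◅_; gmap)

Star-reindex : ∀ {A : Set} {V : A → Set} {E : Rel (Σ A V) 0ℓ} →
  (∀ {y} (p q : V y) → p ≡ q) →
  ∀ {a b p q} → Star E (a , p) (b , q) → ∀ p′ q′ → Star E (a , p′) (b , q′)
Star-reindex {E = E} V-irrelevant {a} {b} {p} {q} walk p′ q′ =
  subst₂ (λ p′ q′ → Star E (a , p′) (b , q′)) (V-irrelevant p p′) (V-irrelevant q q′) walk

connected-transport : ∀ {A : Set} {V W : A → Set} {E F : A → A → Set} →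
  (∀ {y} → W y → V y) → (∀ {y} → V y → W y) → (∀ {y} (p q : W y) → p ≡ q) →
  (∀ {a b} → E a b → F a b) →
  (∀ u v → Star (λ (p q : Σ A V) → E (proj₁ p) (proj₁ q)) u v) →
  (∀ u v → Star (λ (p q : Σ A W) → F (proj₁ p) (proj₁ q)) u v)
connected-transport W⇒V V⇒W W-irrelevant E⇒F V-connected (a , p) (b , q) =
  Star-reindex W-irrelevant (gmap (map₂ V⇒W) E⇒F (V-connected (a , W⇒V p) (b , W⇒V q))) p q

complement-shift : ∀ {t a a′ b b′} c → a + a′ ≡ t → b + b′ ≡ t → b′ ≡ a′ + c → a ≡ b + c
complement-shift {a = a} {a′} {b} {b′} c a+a′≡t b+b′≡t b′≡a′+c =
  +-cancelʳ-≡ a′ a (b + c) (begin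
  a + a′        ≡⟨ trans a+a′≡t (sym b+b′≡t) ⟩
  b + b′        ≡⟨ cong (b +_) (trans b′≡a′+c (+-comm a′ c)) ⟩
  b + (c + a′)  ≡⟨ +-assoc b c a′ ⟨
  b + c + a′    ∎)
  where open ≡-Reasoning

complement-shift⁻ : ∀ {t a a′ b b′} c → a + a′ ≡ t → b + b′ ≡ t → a ≡ b + c → b′ ≡ a′ + c
complement-shift⁻ {a = a} {a′} {b} {b′} c a+a′≡t b+b′≡t a≡b+c =
  +-cancelˡ-≡ b b′ (a′ + c) (begin
  b + b′        ≡⟨ trans b+b′≡t (sym a+a′≡t) ⟩
  a + a′        ≡⟨ cong (_+ a′) a≡b+c ⟩
  b + c + a′    ≡⟨ +-assoc b c a′ ⟩
  b + (c + a′)  ≡⟨ cong (b +_) (+-comm c a′) ⟩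
  b + (a′ + c)  ∎)
  where open ≡-Reasoning

module MaxChainFacts {n : ℕ} {R : Fin n → Fin n → Bool} where
  open Order R

  _++ᶜ_ : ∀ {a b c k l} → MaxChain a b k → MaxChain b c l → MaxChain a c (k + l)
  done             ++ᶜ b→c = b→c
  step a⋖a′ a′→b ++ᶜ b→c = step a⋖a′ (a′→b ++ᶜ b→c)

  maxChain-snoc : ∀ {a b c k} → MaxChain a b k → Covers b c → MaxChain a c (suc k)
  maxChain-snoc done             b⋖c = step b⋖c done
  maxChain-snoc (step a⋖a′ a′→b) b⋖c = step a⋖a′ (maxChain-snoc a′→b b⋖c)

module StrictOrderFacts {n : ℕ} {R : Fin n → Fin n → Bool}
                        (spo : Order.IsStrictPartialOrder R) where
  open Order R

  ⊏-irrefl : ∀ {x} → ¬ x ⊏ x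
  ⊏-irrefl = proj₁ spo _

  ⊏-trans : ∀ {x y z} → x ⊏ y → y ⊏ z → x ⊏ z
  ⊏-trans = proj₂ spo _ _ _

  ⊑-trans : ∀ {x y z} → x ⊑ y → y ⊑ z → x ⊑ z
  ⊑-trans (inj₁ x⊏y) (inj₁ y⊏z) = inj₁ (⊏-trans x⊏y y⊏z)
  ⊑-trans (inj₁ x⊏y) (inj₂ refl) = inj₁ x⊏y
  ⊑-trans (inj₂ refl) y⊑z        = y⊑z

  ⊑-⊏-trans : ∀ {x y z} → x ⊑ y → y ⊏ z → x ⊏ z
  ⊑-⊏-trans (inj₁ x⊏y) y⊏z = ⊏-trans x⊏y y⊏z
  ⊑-⊏-trans (inj₂ refl) y⊏z = y⊏z

  ⊑∧≢⇒⊏ : ∀ {x y} → x ⊑ y → x ≢ y → x ⊏ y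
  ⊑∧≢⇒⊏ (inj₁ x⊏y) _   = x⊏y
  ⊑∧≢⇒⊏ (inj₂ x≡y) x≢y = ⊥-elim (x≢y x≡y)

  ⊑-irrelevant : ∀ {x y} (p q : x ⊑ y) → p ≡ q
  ⊑-irrelevant (inj₁ p)    (inj₁ q)    = cong inj₁ (T-irrelevant p q)
  ⊑-irrelevant (inj₁ p)    (inj₂ refl) = ⊥-elim (⊏-irrefl p)
  ⊑-irrelevant (inj₂ refl) (inj₁ q)    = ⊥-elim (⊏-irrefl q)
  ⊑-irrelevant (inj₂ refl) (inj₂ refl) = refl

  ⊏-isStrictPartialOrder : Structures.IsStrictPartialOrder _≡_ _⊏_
  ⊏-isStrictPartialOrder = record
    { isEquivalence = isEquivalence
    ; irrefl        = λ { refl → ⊏-irrefl }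
    ; trans         = ⊏-trans
    ; <-resp-≈      = resp₂ _⊏_
    }

  ⊏-wellFounded : WellFounded _⊏_
  ⊏-wellFounded = spo-wellFounded ⊏-isStrictPartialOrder

  ⊐-wellFounded : WellFounded (flip _⊏_)
  ⊐-wellFounded = spo-noetherian ⊏-isStrictPartialOrder

  coverBelow : ∀ {x y} → x ⊏ y → Σ[ w ∈ X ] (Covers x w × w ⊑ y)
  coverBelow {y = y} = go (⊏-wellFounded y)
    where
    go : ∀ {x y} → Acc _⊏_ y → x ⊏ y → Σ[ w ∈ X ] (Covers x w × w ⊑ y)
    go {x} {y} (acc rs) x⊏y with any? (λ v → T? (R x v) ×-dec T? (R v y))
    ... | no nothing-between =
      y , (x⊏y , λ v x⊏v v⊏y → nothing-between (v , x⊏v , v⊏y)) , inj₂ refl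
    ... | yes (v , x⊏v , v⊏y) =
      let (w , x⋖w , w⊑v) = go (rs v⊏y) x⊏v in w , x⋖w , ⊑-trans w⊑v (inj₁ v⊏y)

  ⊏⇒maxChain : ∀ {x y} → x ⊏ y → ∃[ k ] MaxChain x y (suc k)
  ⊏⇒maxChain {x} = go (⊐-wellFounded x)
    where
    go : ∀ {x y} → Acc (flip _⊏_) x → x ⊏ y → ∃[ k ] MaxChain x y (suc k)
    go (acc rs) x⊏y with coverBelow x⊏y
    ... | w , x⋖w , inj₂ refl = 0 , step x⋖w done
    ... | w , x⋖w , inj₁ w⊏y =
      let (k , w→y) = go (rs (proj₁ x⋖w)) w⊏y in suc k , step x⋖w w→y

  ⊑⇒maxChain : ∀ {x y} → x ⊑ y → ∃[ k ] MaxChain x y k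
  ⊑⇒maxChain (inj₁ x⊏y) = let (k , x→y) = ⊏⇒maxChain x⊏y in suc k , x→y
  ⊑⇒maxChain (inj₂ refl) = 0 , done

module DualFacts {n : ℕ} (R : Fin n → Fin n → Bool) where
  open Order R
  module D = Order (dual R)
  open MaxChainFacts

  dual-isStrictPartialOrder : IsStrictPartialOrder → D.IsStrictPartialOrder
  dual-isStrictPartialOrder (irr , tr) = irr , λ x y z y⊏x z⊏y → tr z y x z⊏y y⊏x

  ⊑⇒dual : ∀ {a b} → a ⊑ b → b D.⊑ a
  ⊑⇒dual (inj₁ a⊏b) = inj₁ a⊏b
  ⊑⇒dual (inj₂ refl) = inj₂ refl

  dual⇒⊑ : ∀ {a b} → a D.⊑ b → b ⊑ a
  dual⇒⊑ (inj₁ b⊏a) = inj₁ b⊏a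
  dual⇒⊑ (inj₂ refl) = inj₂ refl

  dual-covers⇒covers : ∀ {a b} → D.Covers a b → Covers b a
  dual-covers⇒covers (b⊏a , nothing-between) = b⊏a , λ w b⊏w w⊏a → nothing-between w w⊏a b⊏w

  dual-maxChain⇒maxChain : ∀ {a b k} → D.MaxChain a b k → MaxChain b a k
  dual-maxChain⇒maxChain D.done               = done
  dual-maxChain⇒maxChain (D.step a⋗a′ a′→b) =
    maxChain-snoc (dual-maxChain⇒maxChain a′→b) (dual-covers⇒covers a⋗a′)

  isJoin⇒dual-isMeet : ∀ {a b j} → IsJoin a b j → D.IsMeet a b j
  isJoin⇒dual-isMeet (a⊑j , b⊑j , least) =
    ⊑⇒dual a⊑j , ⊑⇒dual b⊑j , λ c c⊒a c⊒b → ⊑⇒dual (least c (dual⇒⊑ c⊒a) (dual⇒⊑ c⊒b))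

  isMeet⇒dual-isJoin : ∀ {a b m} → IsMeet a b m → D.IsJoin a b m
  isMeet⇒dual-isJoin (m⊑a , m⊑b , greatest) =
    ⊑⇒dual m⊑a , ⊑⇒dual m⊑b , λ c a⊒c b⊒c → ⊑⇒dual (greatest c (dual⇒⊑ a⊒c) (dual⇒⊑ b⊒c))

  dual-isLattice : IsLattice → D.IsLattice
  dual-isLattice (spo , meet , join) =
    dual-isStrictPartialOrder spo ,
    (λ a b → map₂ isJoin⇒dual-isMeet (join a b)) ,
    (λ a b → map₂ isMeet⇒dual-isJoin (meet a b))

  exactlyTwoBetween⇒dual : ∀ {x z} → ExactlyTwoBetween x z → D.ExactlyTwoBetween z x
  exactlyTwoBetween⇒dual (y₁ , y₂ , y₁≢y₂ , (x⊏y₁ , y₁⊏z) , (x⊏y₂ , y₂⊏z) , only) =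
    y₁ , y₂ , y₁≢y₂ , (y₁⊏z , x⊏y₁) , (y₂⊏z , x⊏y₂) , λ y y⊏z x⊏y → only y x⊏y y⊏z

  coverAbove : IsStrictPartialOrder → ∀ {a b} → a ⊏ b → Σ[ c ∈ X ] (a ⊑ c × Covers c b)
  coverAbove spo a⊏b =
    let (c , b⋗c , c⊒a) = StrictOrderFacts.coverBelow (dual-isStrictPartialOrder spo) a⊏b
    in c , dual⇒⊑ c⊒a , dual-covers⇒covers b⋗c

module RankFacts {n : ℕ} {R : Fin n → Fin n → Bool} (spo : Order.IsStrictPartialOrder R)
                 {bot : Fin n} {ρ : Fin n → ℕ}
                 (isBot : Order.IsBottom R bot) (isRank : Order.IsRankFunction R bot ρ) where
  open Order R
  open MaxChainFacts
  open StrictOrderFacts spo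

  rank-maxChain : ∀ {a b k} → MaxChain a b k → ρ b ≡ ρ a + k
  rank-maxChain {a} {b} {k} a→b =
    let (j , bot→a) = ⊑⇒maxChain (isBot a) in begin
      ρ b     ≡⟨ isRank b (j + k) (bot→a ++ᶜ a→b) ⟨
      j + k   ≡⟨ cong (_+ k) (isRank a j bot→a) ⟩
      ρ a + k ∎
    where open ≡-Reasoning

  rank-covers : ∀ {a b} → Covers a b → ρ b ≡ ρ a + 1
  rank-covers a⋖b = rank-maxChain (step a⋖b done)

  rank-mono-< : ∀ {a b} → a ⊏ b → ρ a < ρ b
  rank-mono-< {a} a⊏b =
    let (k , a→b) = ⊏⇒maxChain a⊏b
    in subst (ρ a <_) (sym (rank-maxChain a→b)) (m<m+n (ρ a) z<s)

  rank-mono-≤ : ∀ {a b} → a ⊑ b → ρ a ≤ ρ b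
  rank-mono-≤ (inj₁ a⊏b) = <⇒≤ (rank-mono-< a⊏b)
  rank-mono-≤ (inj₂ refl) = ≤-refl

  rank<⇒⊏ : ∀ {a b} → a ⊑ b → ρ a < ρ b → a ⊏ b
  rank<⇒⊏ (inj₁ a⊏b)  _     = a⊏b
  rank<⇒⊏ (inj₂ refl) ρa<ρa = ⊥-elim (<-irrefl refl ρa<ρa)

  ⊑∧rank≡⇒≡ : ∀ {a b} → a ⊑ b → ρ a ≡ ρ b → a ≡ b
  ⊑∧rank≡⇒≡ (inj₁ a⊏b) ρa≡ρb = ⊥-elim (<-irrefl ρa≡ρb (rank-mono-< a⊏b))
  ⊑∧rank≡⇒≡ (inj₂ a≡b) _     = a≡b

module TopFacts {n : ℕ} {R : Fin n → Fin n → Bool} (spo : Order.IsStrictPartialOrder R)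
                (x₀ : Fin n) (join : ∀ a b → Σ[ j ∈ Fin n ] Order.IsJoin R a b j) where
  open Order R
  open StrictOrderFacts spo

  upperBound : ∀ {m} (f : Fin m → X) → Σ[ t ∈ X ] (∀ i → f i ⊑ t)
  upperBound {zero}  f = x₀ , λ ()
  upperBound {suc m} f =
    let (t , f⁺⊑t) = upperBound (f ∘ suc)
        (j , f₀⊑j , t⊑j , _) = join (f zero) t
    in j , λ { zero → f₀⊑j ; (suc i) → ⊑-trans (f⁺⊑t i) t⊑j }

  top : X
  top = proj₁ (upperBound id)

  isTop : IsTop top
  isTop = proj₂ (upperBound id)

-- Atom z x and AtomAdj z are the vertices and edges of Λ([x,z]) in the dual order.
module Atoms {n : ℕ} (R : Fin n → Fin n → Bool) (ρ : Fin n → ℕ) where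
  open Order R

  Atom : X → X → X → Set
  Atom z x a = z ⊑ a × a ⊑ x × ρ a ≡ ρ z + 1

  AtomAdj : X → X → X → Set
  AtomAdj z a b = a ≢ b × Σ[ j ∈ X ] (IsJoin a b j × ρ j ≡ ρ z + 2)

  AtomWalk : (z x : X) → Σ X (Atom z x) → Σ X (Atom z x) → Set
  AtomWalk z x = Star (λ p q → AtomAdj z (proj₁ p) (proj₁ q))

module AtomGraph {n : ℕ} {R : Fin n → Fin n → Bool} (spo : Order.IsStrictPartialOrder R)
                 {bot : Fin n} {ρ : Fin n → ℕ}
                 (isBot : Order.IsBottom R bot) (isRank : Order.IsRankFunction R bot ρ)
                 (join : ∀ a b → Σ[ j ∈ Fin n ] Order.IsJoin R a b j) where
  open Order R
  open StrictOrderFacts spo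
  open RankFacts spo isBot isRank
  open DualFacts R using (coverAbove)
  open Atoms R ρ

  atom-irrelevant : ∀ {z x a} (p q : Atom z x a) → p ≡ q
  atom-irrelevant (za , ax , ρa) (za′ , ax′ , ρa′)
    rewrite ⊑-irrelevant za za′ | ⊑-irrelevant ax ax′ | ≡-irrelevant ρa ρa′ = refl

  distinct-atoms-adjacent : ∀ {z x a b} → Atom z x a → Atom z x b → a ≢ b →
    ρ x ≤ ρ z + 2 → AtomAdj z a b
  distinct-atoms-adjacent {z} {x} {a} {b} (_ , a⊑x , ρa) (_ , b⊑x , ρb) a≢b ρx≤ρz+2
    with join a b
  ... | j , a⊑j , b⊑j , least = a≢b , j , (a⊑j , b⊑j , least) , ≤-antisym ρj≤ρz+2 ρz+2≤ρj
    where
    open ≤-Reasoning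

    a⊏j : a ⊏ j
    a⊏j = ⊑∧≢⇒⊏ a⊑j λ a≡j →
      a≢b (sym (⊑∧rank≡⇒≡ (subst (b ⊑_) (sym a≡j) b⊑j) (trans ρb (sym ρa))))

    ρj≤ρz+2 : ρ j ≤ ρ z + 2
    ρj≤ρz+2 = begin
      ρ j      ≤⟨ rank-mono-≤ (least x a⊑x b⊑x) ⟩
      ρ x      ≤⟨ ρx≤ρz+2 ⟩
      ρ z + 2  ∎

    ρz+2≤ρj : ρ z + 2 ≤ ρ j
    ρz+2≤ρj = begin
      ρ z + 2        ≡⟨ +-suc (ρ z) 1 ⟩
      suc (ρ z + 1)  ≡⟨ cong suc ρa ⟨
      suc (ρ a)      ≤⟨ rank-mono-< a⊏j ⟩
      ρ j            ∎

  module _ (Λ-connected : ∀ x z → x ⊏ z → ρ x + 2 < ρ z → ΛConnected ρ x z) where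

    module Gap {z x : X} (gap : ρ z + 2 < ρ x)
               (ih : ∀ {c} → c ⊏ x → Connected (Atom z c) (AtomAdj z)) where

      atom⊏ : ∀ {a} → Atom z x a → a ⊏ x
      atom⊏ {a} (_ , a⊑x , ρa) = rank<⇒⊏ a⊑x (begin-strict
        ρ a      ≡⟨ ρa ⟩
        ρ z + 1  <⟨ +-monoʳ-< (ρ z) (n<1+n 1) ⟩
        ρ z + 2  <⟨ gap ⟩
        ρ x      ∎)
        where open ≤-Reasoning

      coatom-above : ∀ {a} → Atom z x a → Σ[ c ∈ X ] (ΛVertex ρ z x c × a ⊑ c)
      coatom-above pa@(z⊑a , _ , _) =
        let (c , a⊑c , c⋖x) = coverAbove spo (atom⊏ pa)
        in c , (⊑-trans z⊑a a⊑c , inj₁ (proj₁ c⋖x) , sym (rank-covers c⋖x)) , a⊑c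

      atoms-below-coatom : ∀ {c a b} → ΛVertex ρ z x c → (pa : Atom z x a) (pb : Atom z x b) →
        a ⊑ c → b ⊑ c → AtomWalk z x (a , pa) (b , pb)
      atoms-below-coatom {c} (_ , c⊑x , ρc+1≡ρx) pa@(z⊑a , _ , ρa) pb@(z⊑b , _ , ρb) a⊑c b⊑c =
        Star-reindex atom-irrelevant
          (gmap (map₂ widen) id (ih c⊏x (_ , z⊑a , a⊑c , ρa) (_ , z⊑b , b⊑c , ρb)))
          pa pb
        where
        c⊏x : c ⊏ x
        c⊏x = rank<⇒⊏ c⊑x (subst (ρ c <_) ρc+1≡ρx (m<m+n (ρ c) z<s))

        widen : ∀ {y} → Atom z c y → Atom z x y
        widen (z⊑y , y⊑c , ρy) = z⊑y , ⊑-trans y⊑c c⊑x , ρy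

      common-atom : ∀ {u w} → ΛVertex ρ z x u → ΛVertex ρ z x w → ΛAdj ρ x u w →
        Σ[ d ∈ X ] (Atom z x d × d ⊑ u × d ⊑ w)
      common-atom (z⊑u , u⊑x , _) (z⊑w , _ , _) (_ , m , (m⊑u , m⊑w , greatest) , ρm+2≡ρx) =
        let (d , z⋖d , d⊑m) = coverBelow (rank<⇒⊏ (greatest z z⊑u z⊑w) ρz<ρm)
        in d , (inj₁ (proj₁ z⋖d) , ⊑-trans d⊑m (⊑-trans m⊑u u⊑x) , rank-covers z⋖d) ,
           ⊑-trans d⊑m m⊑u , ⊑-trans d⊑m m⊑w
        where
        ρz<ρm : ρ z < ρ m
        ρz<ρm = +-cancelʳ-< 2 (ρ z) (ρ m) (subst (ρ z + 2 <_) (sym ρm+2≡ρx) gap)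

      walk-below-coatoms : ∀ {u v} → Star (λ p q → ΛAdj ρ x (proj₁ p) (proj₁ q)) u v →
        ∀ {a b} (pa : Atom z x a) (pb : Atom z x b) → a ⊑ proj₁ u → b ⊑ proj₁ v →
        AtomWalk z x (a , pa) (b , pb)
      walk-below-coatoms {_ , pu} ε pa pb a⊑u b⊑u = atoms-below-coatom pu pa pb a⊑u b⊑u
      walk-below-coatoms {_ , pu} (_◅_ {j = _ , pw} u~w w⇝v) pa pb a⊑u b⊑v =
        let (d , pd , d⊑u , d⊑w) = common-atom pu pw u~w
        in atoms-below-coatom pu pa pd a⊑u d⊑u ◅◅ walk-below-coatoms w⇝v pd pb d⊑w b⊑v

      atoms-connected : Connected (Atom z x) (AtomAdj z)
      atoms-connected (a , pa@(z⊑a , _ , _)) (b , pb) =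
        let (u , pu , a⊑u) = coatom-above pa
            (v , pv , b⊑v) = coatom-above pb
            z⊏x = ⊑-⊏-trans z⊑a (atom⊏ pa)
        in walk-below-coatoms (Λ-connected z x z⊏x gap (u , pu) (v , pv)) pa pb a⊑u b⊑v

    atoms-connected : ∀ z x → Connected (Atom z x) (AtomAdj z)
    atoms-connected z x = go (⊏-wellFounded x)
      where
      go : ∀ {x} → Acc _⊏_ x → Connected (Atom z x) (AtomAdj z)
      go {x} (acc rs) (a , pa) (b , pb) with a ≟ b | ρ z + 2 <? ρ x
      ... | yes refl | _       =
        subst (λ pb → AtomWalk z x (a , pa) (a , pb)) (atom-irrelevant pa pb) ε
      ... | no a≢b   | no ≮gap = distinct-atoms-adjacent pa pb a≢b (≮⇒≥ ≮gap) ◅ ε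
      ... | no _     | yes gap = Gap.atoms-connected gap (go ∘ rs) (a , pa) (b , pb)

module Corank {n : ℕ} {R : Fin n → Fin n → Bool} (spo : Order.IsStrictPartialOrder R)
              {bot : Fin n} {ρ : Fin n → ℕ}
              (isBot : Order.IsBottom R bot) (isRank : Order.IsRankFunction R bot ρ)
              {top : Fin n} (isTop : Order.IsTop R top) where
  open Order R
  open RankFacts spo isBot isRank
  open DualFacts R
  open Atoms R ρ
  private
    module DS = StrictOrderFacts (dual-isStrictPartialOrder spo)

  corank : X → ℕ
  corank y = ρ top ∸ ρ y

  rank+corank : ∀ y → ρ y + corank y ≡ ρ top
  rank+corank y = m+[n∸m]≡n (rank-mono-≤ (isTop y))

  corank-isRankFunction : D.IsRankFunction top corank
  corank-isRankFunction x k top→x = sym (begin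
    corank x       ≡⟨ cong (_∸ ρ x) (rank-maxChain (dual-maxChain⇒maxChain top→x)) ⟩
    ρ x + k ∸ ρ x  ≡⟨ m+n∸m≡n (ρ x) k ⟩
    k              ∎)
    where open ≡-Reasoning

  corank-shift⇒rank-shift : ∀ {y z} c → corank z ≡ corank y + c → ρ y ≡ ρ z + c
  corank-shift⇒rank-shift {y} {z} c = complement-shift c (rank+corank y) (rank+corank z)

  rank-shift⇒corank-shift : ∀ {y z} c → ρ y ≡ ρ z + c → corank z ≡ corank y + c
  rank-shift⇒corank-shift {y} {z} c = complement-shift⁻ c (rank+corank y) (rank+corank z)

  dual-exactlyTwoBetween :
    (∀ x z → x ⊏ z → ρ z ≡ ρ x + 2 → ExactlyTwoBetween x z) →
    ∀ x z → x D.⊏ z → corank z ≡ corank x + 2 → D.ExactlyTwoBetween x z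
  dual-exactlyTwoBetween two-between x z z⊏x corank-gap =
    exactlyTwoBetween⇒dual (two-between z x z⊏x (corank-shift⇒rank-shift 2 corank-gap))

  dual-ΛConnected : (∀ z x → Connected (Atom z x) (AtomAdj z)) → ∀ x z → D.ΛConnected corank x z
  dual-ΛConnected atoms-connected x z =
    connected-transport dualVertex⇒atom atom⇒dualVertex dualVertex-irrelevant
      atomAdj⇒dualAdj (atoms-connected z x)
    where
    dualVertex⇒atom : ∀ {y} → D.ΛVertex corank x z y → Atom z x y
    dualVertex⇒atom (x⊑*y , y⊑*z , corank≡) =
      dual⇒⊑ y⊑*z , dual⇒⊑ x⊑*y , corank-shift⇒rank-shift 1 (sym corank≡)

    atom⇒dualVertex : ∀ {y} → Atom z x y → D.ΛVertex corank x z y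
    atom⇒dualVertex (z⊑y , y⊑x , rank≡) =
      ⊑⇒dual y⊑x , ⊑⇒dual z⊑y , sym (rank-shift⇒corank-shift 1 rank≡)

    dualVertex-irrelevant : ∀ {y} (p q : D.ΛVertex corank x z y) → p ≡ q
    dualVertex-irrelevant (p₁ , p₂ , p₃) (q₁ , q₂ , q₃)
      rewrite DS.⊑-irrelevant p₁ q₁ | DS.⊑-irrelevant p₂ q₂ | ≡-irrelevant p₃ q₃ = refl

    atomAdj⇒dualAdj : ∀ {a b} → AtomAdj z a b → D.ΛAdj corank z a b
    atomAdj⇒dualAdj (a≢b , j , j-join , rank≡) =
      a≢b , j , isJoin⇒dual-isMeet j-join , sym (rank-shift⇒corank-shift 2 rank≡)

corollary2p1 : {n : ℕ} (R : Fin n → Fin n → Bool) →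
    CellularPseudomanifold R → CellularPseudomanifold (dual R)
corollary2p1 R (lattice@(spo , _ , join) , bot , ρ , isBot , isRank , two-between , Λ-connected) =
  dual-isLattice lattice , top , corank , (λ x → ⊑⇒dual (isTop x)) , corank-isRankFunction ,
  dual-exactlyTwoBetween two-between ,
  (λ x z _ _ → dual-ΛConnected (atoms-connected Λ-connected) x z)
  where
  open DualFacts R
  open TopFacts spo bot join
  open Corank spo isBot isRank isTop
  open AtomGraph spo isBot isRank join
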